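{- Let $a(x)$ be a formal power series over $\mathbb{C}$ with $a_0=1$, and for $n\ge0$ let $$h_n(t)=(1-t)^{2n+1}\sum_{m\ge0}\frac{(n+m)!}{m!}[x^n]\big(a^{m+1}(x)\big)t^m$$ be the $n$-th numerator polynomial of the exponential Riordan matrix $(a(x),xa(x))_E$. Then the numerator polynomials are all symmetric, i.e. $h_n(t)=t^nh_n(1/t)$ for every $n\ge0$, if and only if $a(x)=\frac{1}{1-\varphi x}$ for some $\varphi\in\mathbb{C}$ (i.e. the matrix is $|e^x|^{ -1}P^{\varphi}|e^x|$).
   Context: The exponential Riordan matrix $(f(x),g(x))_E$ has $(i,j)$ entry $\frac{i!}{j!}[x^i]f(x)g^j(x)$; its $n$-th numerator polynomial is the polynomial $h_n$ such that the $n$-th descending diagonal (entries at $(n+m,m)$) has generating function $h_n(t)/(1-t)^{2n+1}$; $h_n$ has degree at most $n$. $P^{\varphi}=\big(\frac{1}{1-\varphi x},\frac{x}{1-\varphi x}\big)$ is the power of the Pascal matrix, and $|e^x|^{ -1}P^{\varphi}|e^x|=\big(\frac{1}{1-\varphi x},\frac{x}{1-\varphi x}\big)_E$. The "exponential Bell subgroup" consists of the matrices $(a(x),xa(x))_E$. -}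

module Defs where

open import Level using (Level; _⊔_)
open import Algebra.Bundles using (CommutativeRing)
open import Data.Nat using (ℕ; zero; suc; _≤_; _<_; _∸_)
open import Data.Nat.Combinatorics using (_C_; _P_)
open import Data.Product using (∃)
open import Relation.Nullary using (¬_)

ringFromℕ : ∀ {c ℓ} (R : CommutativeRing c ℓ) → ℕ → CommutativeRing.Carrier R
ringFromℕ R zero    = CommutativeRing.0# R
ringFromℕ R (suc n) = CommutativeRing._+_ R (CommutativeRing.1# R) (ringFromℕ R n)

record Char0Field (c ℓ : Level) : Set (Level.suc (c ⊔ ℓ)) where
  field
    commRing : CommutativeRing c ℓ
  open CommutativeRing commRing public

  fromℕ : ℕ → Carrier
  fromℕ = ringFromℕ commRing

  field
    1≉0      : ¬ (1# ≈ 0#)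
    inverse  : ∀ x → ¬ (x ≈ 0#) → ∃ λ y → x * y ≈ 1#
    char0    : ∀ n → ¬ (fromℕ (suc n) ≈ 0#)

module FPS {c ℓ} (K : Char0Field c ℓ) where
  open Char0Field K

  Series : Set c
  Series = ℕ → Carrier

  sumTo : ℕ → (ℕ → Carrier) → Carrier
  sumTo zero    f = f 0
  sumTo (suc n) f = sumTo n f + f (suc n)

  _⊛_ : Series → Series → Series
  (f ⊛ g) n = sumTo n (λ i → f i * g (n ∸ i))

  _^ₛ_ : Series → ℕ → Series
  (f ^ₛ zero)  zero    = 1#
  (f ^ₛ zero)  (suc n) = 0#
  f ^ₛ (suc m) = f ⊛ (f ^ₛ m)

  _^_ : Carrier → ℕ → Carrier
  x ^ zero  = 1#
  x ^ suc m = x * (x ^ m)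

  sign : ℕ → Carrier
  sign zero    = 1#
  sign (suc j) = - sign j

  -- (n+m)!/m!  =  (n+m) P n  (falling factorial)
  fallingRatio : ℕ → ℕ → ℕ
  fallingRatio n m = (n Data.Nat.+ m) P n

  -- d_n(m) = (n+m)!/m! [x^n] a^{m+1}(x): the (n+m, m) entry of (a(x), x a(x))_E,
  -- i.e. the m-th coefficient of the n-th descending diagonal
  diag : Series → ℕ → ℕ → Carrier
  diag a n m = fromℕ (fallingRatio n m) * (a ^ₛ suc m) n

  -- h_n(t) = (1-t)^{2n+1} Σ_m d_n(m) t^m, as a coefficient sequence:
  -- [t^k] h_n = Σ_{j=0}^{k} (-1)^j C(2n+1, j) d_n(k-j)
  numerator : Series → ℕ → Series
  numerator a n k =
    sumTo k (λ j → sign j * (fromℕ ((2 Data.Nat.* n Data.Nat.+ 1) C j) * diag a n (k ∸ j)))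

  -- h(t) = t^n h(1/t) for a power series h: h is a polynomial of degree ≤ n
  -- whose coefficient sequence is palindromic of length n+1
  SymmetricOfDegree : ℕ → Series → Set ℓ
  SymmetricOfDegree n h =
    (∀ k → k ≤ n → h k ≈ h (n ∸ k)) Data.Product.× (∀ k → n < k → h k ≈ 0#)

  -- the series 1/(1 - φ x) = Σ φ^n x^n
  geometric : Carrier → Series
  geometric φ n = φ ^ n

-- Write d_n(m) for the entries of the n-th diagonal; then h_n = (1 - t)^(2n+1) Σ_m d_n(m) t^m is the
-- (2n+1)-fold backward difference ∇ of d_n.
--
-- If a = 1/(1 - φx), then [x^n] a^(m+1) = C(m+n,m) φ^n, so d_n(m) = φ^n n! C(n+m,n)².  Expanding
-- C(n+m,n)² = Σ_k C(n,k) C(n+k,k) C(n+m,n+k) (Vandermonde) and using that m ↦ C(n+m,n+k) is t^k/(1-t)^(n+k+1)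
-- gives h_n(t) = φ^n n! Σ_k C(n,k) C(n+k,k) t^k (1-t)^(n-k) = φ^n n! Σ_l C(n,l)² t^l, a palindrome.
--
-- Conversely take φ = a_1 and suppose a agrees with 1/(1 - φx) below degree N ≥ 2.  With ε = a_N - φ^N,
-- [x^N] a^(m+1) gains exactly (m+1)ε, so h_N is the geometric numerator plus ε times the numerator of
-- (N+m)!/m! (m+1), whose constant coefficient is N! and whose coefficient of t^N is -N! N (-1)^N.
-- Comparing the coefficients of t^0 and t^N gives ε N! (1 + N (-1)^N) = 0, hence ε = 0 in characteristic 0.

module Submission where

open import Defs
open import Data.Nat as ℕ using (ℕ; zero; suc; z≤n; s≤s; _∸_; _!)
import Data.Nat.Properties as ℕ
open import Data.Nat.Combinatorics using (_C_; _P_; nCk+nC[k+1]≡[n+1]C[k+1]; nCn≡1; k>n⇒nCk≡0; nCk≡nC[n∸k]; nPn≡n!)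
open import Data.Nat.Tactic.RingSolver using (solve-∀)
open import Data.Product using (∃; _,_)
open import Data.Sum using (_⊎_; inj₁; inj₂)
open import Function.Bundles using (_⇔_; mk⇔)
open import Relation.Nullary using (¬_; yes; no)
open import Relation.Binary.PropositionalEquality as ≡ using (_≡_)

module BinomialIdentities where
  open import Data.Nat using (suc; _+_; _*_; _∸_; _≤_; _!; _≤?_; NonZero)
  open import Data.Nat.Properties
  open import Algebra.Properties.CommutativeSemigroup *-commutativeSemigroup using (xy∙z≈y∙xz)
  open import Data.Nat.Combinatorics using (_C_; _P_; nCk≡n!/k![n-k]!; k>n⇒nCk≡0; nPk≡n!/[n∸k]!; k![n∸k]!∣n!; nCk≡nC[n∸k])
  open import Data.Nat.DivMod using (_/_; m/n*n≡m; m*n/n≡m)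
  open import Data.Nat.Tactic.RingSolver using (solve-∀)
  open import Relation.Binary.PropositionalEquality
  open import Relation.Nullary using (yes; no)
  open ≡-Reasoning

  private
    [a*b]*[c*[d*e]]≡a*[c*[b*[d*e]]] : ∀ a b c d e → a * b * (c * (d * e)) ≡ a * (c * (b * (d * e)))
    [a*b]*[c*[d*e]]≡a*[c*[b*[d*e]]] = solve-∀
    [a*b]*[c*[d*e]]≡a*[[b*[c*d]]*e] : ∀ a b c d e → a * b * (c * (d * e)) ≡ a * ((b * (c * d)) * e)
    [a*b]*[c*[d*e]]≡a*[[b*[c*d]]*e] = solve-∀
    [a*b]*[c*[d*e]]≡b*[[a*[d*c]]*e] : ∀ a b c d e → a * b * (c * (d * e)) ≡ b * ((a * (d * c)) * e)
    [a*b]*[c*[d*e]]≡b*[[a*[d*c]]*e] = solve-∀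
    [a*b]*[c*d]≡b*[[a*c]*d] : ∀ a b c d → a * b * (c * d) ≡ b * ((a * c) * d)
    [a*b]*[c*d]≡b*[[a*c]*d] = solve-∀
    cancel-common-factor : ∀ {x y z} d .{{_ : NonZero d}} → x * d ≡ z → y * d ≡ z → x ≡ y
    cancel-common-factor d xd≡z yd≡z = *-cancelʳ-≡ _ _ d (trans xd≡z (sym yd≡z))

  nCk*[k!*[n∸k]!]≡n! : ∀ {n k} → k ≤ n → (n C k) * (k ! * (n ∸ k) !) ≡ n !
  nCk*[k!*[n∸k]!]≡n! {n} {k} k≤n = begin
    (n C k) * (k ! * (n ∸ k) !)                   ≡⟨ cong (_* (k ! * (n ∸ k) !)) (nCk≡n!/k![n-k]! k≤n) ⟩
    (n ! / (k ! * (n ∸ k) !)) * (k ! * (n ∸ k) !) ≡⟨ m/n*n≡m (k![n∸k]!∣n! k≤n) ⟩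
    n !                                           ∎
    where instance _ = k !* (n ∸ k) !≢0

  [m+n]Cm*[m!*n!]≡[m+n]! : ∀ m n → ((m + n) C m) * (m ! * n !) ≡ (m + n) !
  [m+n]Cm*[m!*n!]≡[m+n]! m n =
    subst (λ x → ((m + n) C m) * (m ! * x !) ≡ (m + n) !) (m+n∸m≡n m n) (nCk*[k!*[n∸k]!]≡n! (m≤m+n m n))

  [m+n]Cm≡[m+n]Cn : ∀ m n → (m + n) C m ≡ (m + n) C n
  [m+n]Cm≡[m+n]Cn m n = trans (nCk≡nC[n∸k] (m≤m+n m n)) (cong ((m + n) C_) (m+n∸m≡n m n))

  [n+m]Pn≡n!*[n+m]Cn : ∀ n m → (n + m) P n ≡ n ! * ((n + m) C n)
  [n+m]Pn≡n!*[n+m]Cn n m = begin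
    (n + m) P n                                         ≡⟨ nPk≡n!/[n∸k]! (m≤m+n n m) ⟩
    ((n + m) ! / ((n + m) ∸ n) !) {{((n + m) ∸ n) !≢0}} ≡⟨ divide-by-factorial (m+n∸m≡n n m) ⟩
    ((n + m) ! / m !) {{m !≢0}}                         ≡⟨ cong (λ x → (x / m !) {{m !≢0}}) factorised ⟨
    ((n ! * ((n + m) C n)) * m ! / m !) {{m !≢0}}       ≡⟨ m*n/n≡m (n ! * ((n + m) C n)) (m !) {{m !≢0}} ⟩
    n ! * ((n + m) C n)                                 ∎
    where
    divide-by-factorial : ∀ {x y} → x ≡ y → ((n + m) ! / x !) {{x !≢0}} ≡ ((n + m) ! / y !) {{y !≢0}}
    divide-by-factorial refl = refl
    factorised : (n ! * ((n + m) C n)) * m ! ≡ (n + m) !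
    factorised = trans (xy∙z≈y∙xz (n !) ((n + m) C n) (m !)) ([m+n]Cm*[m!*n!]≡[m+n]! n m)

  nCk*[n∸k]C[l∸k]≡nCl*lCk : ∀ n {k l} → k ≤ l → (n C k) * ((n ∸ k) C (l ∸ k)) ≡ (n C l) * (l C k)
  nCk*[n∸k]C[l∸k]≡nCl*lCk n {k} {l} k≤l with l ≤? n
  ... | yes l≤n = cancel-common-factor (k ! * ((l ∸ k) ! * (n ∸ l) !)) {{m*n≢0 _ _ {{k !≢0}} {{(l ∸ k) !* (n ∸ l) !≢0}}}} lhs rhs
    where
    n∸k∸[l∸k]≡n∸l : (n ∸ k) ∸ (l ∸ k) ≡ n ∸ l
    n∸k∸[l∸k]≡n∸l = trans (∸-+-assoc n k (l ∸ k)) (cong (n ∸_) (m+[n∸m]≡n k≤l))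
    lhs : (n C k) * ((n ∸ k) C (l ∸ k)) * (k ! * ((l ∸ k) ! * (n ∸ l) !)) ≡ n !
    lhs = begin
      (n C k) * ((n ∸ k) C (l ∸ k)) * (k ! * ((l ∸ k) ! * (n ∸ l) !))   ≡⟨ [a*b]*[c*[d*e]]≡a*[c*[b*[d*e]]] (n C k) ((n ∸ k) C (l ∸ k)) (k !) ((l ∸ k) !) ((n ∸ l) !) ⟩
      (n C k) * (k ! * (((n ∸ k) C (l ∸ k)) * ((l ∸ k) ! * (n ∸ l) !))) ≡⟨ cong (λ x → (n C k) * (k ! * x)) inner ⟩
      (n C k) * (k ! * (n ∸ k) !)                                       ≡⟨ nCk*[k!*[n∸k]!]≡n! (≤-trans k≤l l≤n) ⟩
      n !                                                               ∎
      where
      inner : ((n ∸ k) C (l ∸ k)) * ((l ∸ k) ! * (n ∸ l) !) ≡ (n ∸ k) !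
      inner = subst (λ x → ((n ∸ k) C (l ∸ k)) * ((l ∸ k) ! * x !) ≡ (n ∸ k) !) n∸k∸[l∸k]≡n∸l
                    (nCk*[k!*[n∸k]!]≡n! (∸-monoˡ-≤ k l≤n))
    rhs : (n C l) * (l C k) * (k ! * ((l ∸ k) ! * (n ∸ l) !)) ≡ n !
    rhs = begin
      (n C l) * (l C k) * (k ! * ((l ∸ k) ! * (n ∸ l) !))   ≡⟨ [a*b]*[c*[d*e]]≡a*[[b*[c*d]]*e] (n C l) (l C k) (k !) ((l ∸ k) !) ((n ∸ l) !) ⟩
      (n C l) * (((l C k) * (k ! * (l ∸ k) !)) * (n ∸ l) !) ≡⟨ cong (λ x → (n C l) * (x * (n ∸ l) !)) (nCk*[k!*[n∸k]!]≡n! k≤l) ⟩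
      (n C l) * (l ! * (n ∸ l) !)                           ≡⟨ nCk*[k!*[n∸k]!]≡n! l≤n ⟩
      n !                                                   ∎
  ... | no l≰n = begin
    (n C k) * ((n ∸ k) C (l ∸ k)) ≡⟨ lhs≡0 ⟩
    0                             ≡⟨ cong (_* (l C k)) (k>n⇒nCk≡0 (≰⇒> l≰n)) ⟨
    (n C l) * (l C k)             ∎
    where
    lhs≡0 : (n C k) * ((n ∸ k) C (l ∸ k)) ≡ 0
    lhs≡0 with k ≤? n
    ... | yes k≤n = trans (cong ((n C k) *_) (k>n⇒nCk≡0 (∸-monoˡ-< (≰⇒> l≰n) k≤n))) (*-zeroʳ (n C k))
    ... | no k≰n  = cong (_* ((n ∸ k) C (l ∸ k))) (k>n⇒nCk≡0 (≰⇒> k≰n))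

  [n+m]Cn*mCk≡[n+k]Ck*[n+m]C[n+k] : ∀ n m k → ((n + m) C n) * (m C k) ≡ ((n + k) C k) * ((n + m) C (n + k))
  [n+m]Cn*mCk≡[n+k]Ck*[n+m]C[n+k] n m k with k ≤? m
  ... | yes k≤m = cancel-common-factor (n ! * (k ! * (m ∸ k) !)) {{m*n≢0 _ _ {{n !≢0}} {{k !* (m ∸ k) !≢0}}}} lhs rhs
    where
    lhs : ((n + m) C n) * (m C k) * (n ! * (k ! * (m ∸ k) !)) ≡ (n + m) !
    lhs = begin
      ((n + m) C n) * (m C k) * (n ! * (k ! * (m ∸ k) !))   ≡⟨ [a*b]*[c*[d*e]]≡a*[c*[b*[d*e]]] ((n + m) C n) (m C k) (n !) (k !) ((m ∸ k) !) ⟩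
      ((n + m) C n) * (n ! * ((m C k) * (k ! * (m ∸ k) !))) ≡⟨ cong (λ x → ((n + m) C n) * (n ! * x)) (nCk*[k!*[n∸k]!]≡n! k≤m) ⟩
      ((n + m) C n) * (n ! * m !)                           ≡⟨ [m+n]Cm*[m!*n!]≡[m+n]! n m ⟩
      (n + m) !                                             ∎
    rhs : ((n + k) C k) * ((n + m) C (n + k)) * (n ! * (k ! * (m ∸ k) !)) ≡ (n + m) !
    rhs = begin
      ((n + k) C k) * ((n + m) C (n + k)) * (n ! * (k ! * (m ∸ k) !))   ≡⟨ [a*b]*[c*[d*e]]≡b*[[a*[d*c]]*e] ((n + k) C k) ((n + m) C (n + k)) (n !) (k !) ((m ∸ k) !) ⟩
      ((n + m) C (n + k)) * ((((n + k) C k) * (k ! * n !)) * (m ∸ k) !) ≡⟨ cong (λ x → ((n + m) C (n + k)) * (x * (m ∸ k) !)) [n+k]Ck-factorials ⟩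
      ((n + m) C (n + k)) * ((n + k) ! * (m ∸ k) !)                     ≡⟨ [n+m]C[n+k]-factorials ⟩
      (n + m) !                                                         ∎
      where
      [n+k]Ck-factorials : ((n + k) C k) * (k ! * n !) ≡ (n + k) !
      [n+k]Ck-factorials = subst (λ x → ((n + k) C k) * (k ! * x !) ≡ (n + k) !) (m+n∸n≡m n k)
                                 (nCk*[k!*[n∸k]!]≡n! (m≤n+m k n))
      [n+m]C[n+k]-factorials : ((n + m) C (n + k)) * ((n + k) ! * (m ∸ k) !) ≡ (n + m) !
      [n+m]C[n+k]-factorials = subst (λ x → ((n + m) C (n + k)) * ((n + k) ! * x !) ≡ (n + m) !) ([m+n]∸[m+o]≡n∸o n m k)
                                     (nCk*[k!*[n∸k]!]≡n! (+-monoʳ-≤ n k≤m))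
  ... | no k≰m = begin
    ((n + m) C n) * (m C k)             ≡⟨ cong (((n + m) C n) *_) (k>n⇒nCk≡0 (≰⇒> k≰m)) ⟩
    ((n + m) C n) * 0                   ≡⟨ *-zeroʳ ((n + m) C n) ⟩
    0                                   ≡⟨ *-zeroʳ ((n + k) C k) ⟨
    ((n + k) C k) * 0                   ≡⟨ cong (((n + k) C k) *_) (k>n⇒nCk≡0 (+-monoʳ-< n (≰⇒> k≰m))) ⟨
    ((n + k) C k) * ((n + m) C (n + k)) ∎

  [n+m]Pn*[m+n]Cm≡n!*[n+m]Cn² : ∀ n m → ((n + m) P n) * ((m + n) C m) ≡ n ! * (((n + m) C n) * ((n + m) C n))
  [n+m]Pn*[m+n]Cm≡n!*[n+m]Cn² n m = begin
    ((n + m) P n) * ((m + n) C m)         ≡⟨ cong₂ _*_ ([n+m]Pn≡n!*[n+m]Cn n m) [m+n]Cm≡[n+m]Cn ⟩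
    (n ! * ((n + m) C n)) * ((n + m) C n) ≡⟨ *-assoc (n !) ((n + m) C n) ((n + m) C n) ⟩
    n ! * (((n + m) C n) * ((n + m) C n)) ∎
    where
    [m+n]Cm≡[n+m]Cn : (m + n) C m ≡ (n + m) C n
    [m+n]Cm≡[n+m]Cn = trans ([m+n]Cm≡[m+n]Cn m n) (cong (_C n) (+-comm m n))

  [1+n]*[1+n+m]C[1+n]≡[1+n+m]*[n+m]Cn : ∀ n m → suc n * ((suc n + m) C suc n) ≡ suc (n + m) * ((n + m) C n)
  [1+n]*[1+n+m]C[1+n]≡[1+n+m]*[n+m]Cn n m = cancel-common-factor (n ! * m !) {{n !* m !≢0}} lhs rhs
    where
    lhs : suc n * ((suc n + m) C suc n) * (n ! * m !) ≡ (suc n + m) !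
    lhs = trans ([a*b]*[c*d]≡b*[[a*c]*d] (suc n) ((suc n + m) C suc n) (n !) (m !)) ([m+n]Cm*[m!*n!]≡[m+n]! (suc n) m)
    rhs : suc (n + m) * ((n + m) C n) * (n ! * m !) ≡ (suc n + m) !
    rhs = trans (*-assoc (suc (n + m)) ((n + m) C n) (n ! * m !)) (cong (suc (n + m) *_) ([m+n]Cm*[m!*n!]≡[m+n]! n m))

  [n+m]Pn*[1+m]+n!*n*[n+m]Cn≡n!*[1+n]*[1+n+m]C[1+n] : ∀ n m →
    ((n + m) P n) * suc m + (n ! * n) * ((n + m) C n) ≡ (n ! * suc n) * ((suc n + m) C suc n)
  [n+m]Pn*[1+m]+n!*n*[n+m]Cn≡n!*[1+n]*[1+n+m]C[1+n] n m = begin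
    ((n + m) P n) * suc m + (n ! * n) * ((n + m) C n)       ≡⟨ cong (λ x → x * suc m + (n ! * n) * ((n + m) C n)) ([n+m]Pn≡n!*[n+m]Cn n m) ⟩
    n ! * ((n + m) C n) * suc m + (n ! * n) * ((n + m) C n) ≡⟨ collect (n !) ((n + m) C n) n m ⟩
    n ! * (suc (n + m) * ((n + m) C n))                     ≡⟨ cong (n ! *_) ([1+n]*[1+n+m]C[1+n]≡[1+n+m]*[n+m]Cn n m) ⟨
    n ! * (suc n * ((suc n + m) C suc n))                   ≡⟨ *-assoc (n !) (suc n) ((suc n + m) C suc n) ⟨
    (n ! * suc n) * ((suc n + m) C suc n)                   ∎
    where
    collect : ∀ f x n m → f * x * suc m + (f * n) * x ≡ f * (suc (n + m) * x)
    collect = solve-∀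

module Development {c ℓ} (K : Char0Field c ℓ) where
  open Char0Field K hiding (zero)
  open FPS K
  open import Relation.Binary.Reasoning.Setoid setoid
  open import Algebra.Properties.Ring ring using (-‿distribˡ-*; -‿distribʳ-*)
  open import Algebra.Properties.AbelianGroup +-abelianGroup using (⁻¹-∙-comm)
  open import Algebra.Properties.Group +-group using (ε⁻¹≈ε; ⁻¹-involutive) renaming (∙-cancelˡ to +-cancelˡ)
  open import Algebra.Properties.CommutativeSemigroup +-commutativeSemigroup
    using (interchange) renaming (x∙yz≈y∙xz to x+[y+z]≈y+[x+z])
  open import Algebra.Properties.CommutativeSemigroup *-commutativeSemigroup
    using () renaming (x∙yz≈y∙xz to x*[y*z]≈y*[x*z]; interchange to *-interchange)
  import Algebra.Properties.Semiring.Mult semiring as Mult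
  open BinomialIdentities

  x≈y+z⇒x-z≈y : ∀ {x y z} → x ≈ y + z → x - z ≈ y
  x≈y+z⇒x-z≈y {x} {y} {z} x≈y+z = begin
    x - z       ≈⟨ +-congʳ x≈y+z ⟩
    y + z - z   ≈⟨ +-assoc y z (- z) ⟩
    y + (z - z) ≈⟨ +-congˡ (-‿inverseʳ z) ⟩
    y + 0#      ≈⟨ +-identityʳ y ⟩
    y           ∎

  -‿+-distrib : ∀ x y → - (x + y) ≈ - x + - y
  -‿+-distrib x y = sym (⁻¹-∙-comm x y)

  x≈y+[x-y] : ∀ x y → x ≈ y + (x - y)
  x≈y+[x-y] x y = sym (begin
    y + (x - y)   ≈⟨ +-comm y (x - y) ⟩
    x - y + y     ≈⟨ +-assoc x (- y) y ⟩
    x + (- y + y) ≈⟨ +-congˡ (-‿inverseˡ y) ⟩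
    x + 0#        ≈⟨ +-identityʳ x ⟩
    x             ∎)

  x*y≈0⇒x≈0 : ∀ {x y} → ¬ (y ≈ 0#) → x * y ≈ 0# → x ≈ 0#
  x*y≈0⇒x≈0 {x} {y} y≉0 xy≈0 with inverse y y≉0
  ... | y⁻¹ , yy⁻¹≈1 = begin
    x             ≈⟨ *-identityʳ x ⟨
    x * 1#        ≈⟨ *-congˡ yy⁻¹≈1 ⟨
    x * (y * y⁻¹) ≈⟨ *-assoc x y y⁻¹ ⟨
    (x * y) * y⁻¹ ≈⟨ *-congʳ xy≈0 ⟩
    0# * y⁻¹      ≈⟨ zeroˡ y⁻¹ ⟩
    0#            ∎

  x≉0∧y≉0⇒x*y≉0 : ∀ {x y} → ¬ (x ≈ 0#) → ¬ (y ≈ 0#) → ¬ (x * y ≈ 0#)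
  x≉0∧y≉0⇒x*y≉0 {x} {y} x≉0 y≉0 xy≈0 = y≉0 (x*y≈0⇒x≈0 x≉0 (trans (*-comm y x) xy≈0))

  sumTo-cong : ∀ n {f g : ℕ → Carrier} → (∀ i → i ℕ.≤ n → f i ≈ g i) → sumTo n f ≈ sumTo n g
  sumTo-cong zero    f≈g = f≈g 0 z≤n
  sumTo-cong (suc n) f≈g = +-cong (sumTo-cong n (λ i i≤n → f≈g i (ℕ.m≤n⇒m≤1+n i≤n))) (f≈g (suc n) ℕ.≤-refl)

  sumTo-+ : ∀ n (f g : ℕ → Carrier) → sumTo n (λ i → f i + g i) ≈ sumTo n f + sumTo n g
  sumTo-+ zero    f g = refl
  sumTo-+ (suc n) f g = trans (+-congʳ (sumTo-+ n f g)) (interchange _ _ _ _)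

  sumTo-*ˡ : ∀ n x (f : ℕ → Carrier) → x * sumTo n f ≈ sumTo n (λ i → x * f i)
  sumTo-*ˡ zero    x f = refl
  sumTo-*ˡ (suc n) x f = trans (distribˡ x _ _) (+-congʳ (sumTo-*ˡ n x f))

  sumTo-neg : ∀ n (f : ℕ → Carrier) → - sumTo n f ≈ sumTo n (λ i → - f i)
  sumTo-neg zero    f = refl
  sumTo-neg (suc n) f = trans (-‿+-distrib _ _) (+-congʳ (sumTo-neg n f))

  sumTo-zero : ∀ n (f : ℕ → Carrier) → (∀ i → i ℕ.≤ n → f i ≈ 0#) → sumTo n f ≈ 0#
  sumTo-zero n f f≈0 = trans (sumTo-cong n f≈0) (sumTo-const0 n)
    where
    sumTo-const0 : ∀ n → sumTo n (λ _ → 0#) ≈ 0#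
    sumTo-const0 zero    = refl
    sumTo-const0 (suc n) = trans (+-identityʳ _) (sumTo-const0 n)

  sumTo-unfoldˡ : ∀ n (f : ℕ → Carrier) → sumTo (suc n) f ≈ f 0 + sumTo n (λ i → f (suc i))
  sumTo-unfoldˡ zero    f = refl
  sumTo-unfoldˡ (suc n) f = trans (+-congʳ (sumTo-unfoldˡ n f)) (+-assoc _ _ _)

  sumTo-last : ∀ n (f : ℕ → Carrier) → (∀ j → j ℕ.< n → f j ≈ 0#) → sumTo n f ≈ f n
  sumTo-last zero    f f≈0 = refl
  sumTo-last (suc n) f f≈0 = trans (+-congʳ (sumTo-zero n f (λ j j≤n → f≈0 j (s≤s j≤n)))) (+-identityˡ _)

  sumTo-truncate : ∀ {p n} (f : ℕ → Carrier) → p ℕ.≤ n → (∀ j → p ℕ.< j → f j ≈ 0#) → sumTo n f ≈ sumTo p f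
  sumTo-truncate {p} {n} f p≤n f≈0 with ℕ.m≤n⇒∃[o]m+o≡n p≤n
  ... | d , ≡.refl = extend d
    where
    extend : ∀ d → sumTo (p ℕ.+ d) f ≈ sumTo p f
    extend zero    rewrite ℕ.+-identityʳ p = refl
    extend (suc d) rewrite ℕ.+-suc p d =
      trans (+-cong (extend d) (f≈0 (suc (p ℕ.+ d)) (s≤s (ℕ.m≤m+n p d)))) (+-identityʳ _)

  fromℕ≡×1# : ∀ n → fromℕ n ≡ n Mult.× 1#
  fromℕ≡×1# zero    = ≡.refl
  fromℕ≡×1# (suc n) = ≡.cong (1# +_) (fromℕ≡×1# n)

  fromℕ-+ : ∀ m n → fromℕ (m ℕ.+ n) ≈ fromℕ m + fromℕ n
  fromℕ-+ m n rewrite fromℕ≡×1# (m ℕ.+ n) | fromℕ≡×1# m | fromℕ≡×1# n = Mult.×-homo-+ 1# m n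

  fromℕ-* : ∀ m n → fromℕ (m ℕ.* n) ≈ fromℕ m * fromℕ n
  fromℕ-* m n rewrite fromℕ≡×1# (m ℕ.* n) | fromℕ≡×1# m | fromℕ≡×1# n = Mult.×1-homo-* m n

  fromℕ-cong : ∀ {m n} → m ≡ n → fromℕ m ≈ fromℕ n
  fromℕ-cong ≡.refl = refl

  binom : ℕ → ℕ → Carrier
  binom n k = fromℕ (n C k)

  binom-pascal : ∀ n k → binom (suc n) (suc k) ≈ binom n k + binom n (suc k)
  binom-pascal n k = trans (fromℕ-cong (≡.sym (nCk+nC[k+1]≡[n+1]C[k+1] n k))) (fromℕ-+ (n C k) (n C suc k))

  binom-zero : ∀ {n k} → n ℕ.< k → binom n k ≈ 0#
  binom-zero n<k = fromℕ-cong (k>n⇒nCk≡0 n<k)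

  binom-diag : ∀ n → binom n n ≈ 1#
  binom-diag n = trans (fromℕ-cong (nCn≡1 n)) (+-identityʳ 1#)

  binom[n+0]n≈1 : ∀ n → binom (n ℕ.+ 0) n ≈ 1#
  binom[n+0]n≈1 n rewrite ℕ.+-identityʳ n = binom-diag n

  sign-suc∸ : ∀ {l k} → k ℕ.≤ l → sign (suc l ∸ k) ≈ - sign (l ∸ k)
  sign-suc∸ k≤l rewrite ℕ.+-∸-assoc 1 k≤l = refl

  sign≈±1 : ∀ n → sign n ≈ 1# ⊎ sign n ≈ - 1#
  sign≈±1 zero = inj₁ refl
  sign≈±1 (suc n) with sign≈±1 n
  ... | inj₁ s≈1  = inj₂ (-‿cong s≈1)
  ... | inj₂ s≈-1 = inj₁ (trans (-‿cong s≈-1) (⁻¹-involutive 1#))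

  sumTo-pascal : ∀ p k (h : ℕ → Carrier) →
    sumTo (suc k) (λ j → binom (suc p) j * h j)
      ≈ sumTo k (λ j → binom p j * h (suc j)) + sumTo (suc k) (λ j → binom p j * h j)
  sumTo-pascal p k h = begin
    sumTo (suc k) (λ j → binom (suc p) j * h j)
      ≈⟨ sumTo-unfoldˡ k _ ⟩
    binom p 0 * h 0 + sumTo k (λ j → binom (suc p) (suc j) * h (suc j))
      ≈⟨ +-congˡ (sumTo-cong k (λ j _ → trans (*-congʳ (binom-pascal p j)) (distribʳ _ _ _))) ⟩
    binom p 0 * h 0 + sumTo k (λ j → A j + B j)
      ≈⟨ +-congˡ (sumTo-+ k A B) ⟩
    binom p 0 * h 0 + (sumTo k A + sumTo k B)
      ≈⟨ x+[y+z]≈y+[x+z] _ _ _ ⟩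
    sumTo k A + (binom p 0 * h 0 + sumTo k B)
      ≈⟨ +-congˡ (sumTo-unfoldˡ k _) ⟨
    sumTo k A + sumTo (suc k) (λ j → binom p j * h j) ∎
    where
    A B : ℕ → Carrier
    A j = binom p j * h (suc j)
    B j = binom p (suc j) * h (suc j)

  sumTo-dropLast : ∀ n (f : ℕ → Carrier) → f (suc n) ≈ 0# → sumTo (suc n) f ≈ sumTo n f
  sumTo-dropLast n f f[n+1]≈0 = trans (+-congˡ f[n+1]≈0) (+-identityʳ _)

  vandermonde : ∀ n m r → sumTo n (λ k → binom n k * binom m (k ℕ.+ r)) ≈ binom (n ℕ.+ m) (n ℕ.+ r)
  vandermonde zero    m r = trans (*-congʳ (binom-diag 0)) (*-identityˡ _)
  vandermonde (suc n) m r = begin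
    sumTo (suc n) (λ k → binom (suc n) k * binom m (k ℕ.+ r))
      ≈⟨ sumTo-pascal n n _ ⟩
    sumTo n (λ k → binom n k * binom m (suc k ℕ.+ r)) + sumTo (suc n) (λ k → binom n k * binom m (k ℕ.+ r))
      ≈⟨ +-cong (sumTo-cong n (λ k _ → *-congˡ (fromℕ-cong (≡.cong (m C_) (≡.sym (ℕ.+-suc k r))))))
                (sumTo-dropLast n _ (trans (*-congʳ (binom-zero (ℕ.n<1+n n))) (zeroˡ _))) ⟩
    sumTo n (λ k → binom n k * binom m (k ℕ.+ suc r)) + sumTo n (λ k → binom n k * binom m (k ℕ.+ r))
      ≈⟨ +-cong (vandermonde n m (suc r)) (vandermonde n m r) ⟩
    binom (n ℕ.+ m) (n ℕ.+ suc r) + binom (n ℕ.+ m) (n ℕ.+ r)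
      ≈⟨ +-comm _ _ ⟩
    binom (n ℕ.+ m) (n ℕ.+ r) + binom (n ℕ.+ m) (n ℕ.+ suc r)
      ≈⟨ +-congˡ (fromℕ-cong (≡.cong ((n ℕ.+ m) C_) (ℕ.+-suc n r))) ⟩
    binom (n ℕ.+ m) (n ℕ.+ r) + binom (n ℕ.+ m) (suc (n ℕ.+ r))
      ≈⟨ binom-pascal (n ℕ.+ m) (n ℕ.+ r) ⟨
    binom (suc n ℕ.+ m) (suc n ℕ.+ r) ∎

  alternating-binom-sum : ∀ l M c →
    sumTo l (λ k → binom l k * (sign (l ∸ k) * binom (M ℕ.+ k) (c ℕ.+ k))) ≈ binom M (c ℕ.+ l)
  alternating-binom-sum zero    M c = begin
    binom 0 0 * (1# * binom (M ℕ.+ 0) (c ℕ.+ 0)) ≈⟨ trans (*-congʳ (binom-diag 0)) (*-identityˡ _) ⟩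
    1# * binom (M ℕ.+ 0) (c ℕ.+ 0)               ≈⟨ *-identityˡ _ ⟩
    binom (M ℕ.+ 0) (c ℕ.+ 0)                    ≈⟨ fromℕ-cong (≡.cong (_C (c ℕ.+ 0)) (ℕ.+-identityʳ M)) ⟩
    binom M (c ℕ.+ 0)                            ∎
  alternating-binom-sum (suc l) M c = begin
    sumTo (suc l) (λ k → binom (suc l) k * h k)
      ≈⟨ sumTo-pascal l l h ⟩
    sumTo l (λ k → binom l k * h (suc k)) + sumTo (suc l) (λ k → binom l k * h k)
      ≈⟨ +-cong (trans (sumTo-cong l (λ k _ → *-congˡ (*-congˡ (fromℕ-cong (≡.cong₂ _C_ (ℕ.+-suc M k) (ℕ.+-suc c k))))))
                       (alternating-binom-sum l (suc M) (suc c)))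
                (sumTo-dropLast l _ (trans (*-congʳ (binom-zero (ℕ.n<1+n l))) (zeroˡ _))) ⟩
    binom (suc M) (suc c ℕ.+ l) + sumTo l (λ k → binom l k * h k)
      ≈⟨ +-congˡ (trans (sumTo-cong l (λ k k≤l → trans (*-congˡ (trans (*-congʳ (sign-suc∸ k≤l)) (sym (-‿distribˡ-* _ _))))
                                                        (sym (-‿distribʳ-* _ _))))
                        (sym (sumTo-neg l _))) ⟩
    binom (suc M) (suc c ℕ.+ l) - sumTo l (λ k → binom l k * (sign (l ∸ k) * binom (M ℕ.+ k) (c ℕ.+ k)))
      ≈⟨ +-congˡ (-‿cong (alternating-binom-sum l M c)) ⟩
    binom (suc M) (suc (c ℕ.+ l)) - binom M (c ℕ.+ l)
      ≈⟨ x≈y+z⇒x-z≈y (trans (binom-pascal M (c ℕ.+ l)) (+-comm _ _)) ⟩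
    binom M (suc (c ℕ.+ l))
      ≈⟨ fromℕ-cong (≡.cong (M C_) (ℕ.+-suc c l)) ⟨
    binom M (c ℕ.+ suc l) ∎
    where
    h : ℕ → Carrier
    h k = sign (suc l ∸ k) * binom (M ℕ.+ k) (c ℕ.+ k)

  hockey-stick : ∀ m n → sumTo n (λ i → binom (m ℕ.+ (n ∸ i)) m) ≈ binom (suc m ℕ.+ n) (suc m)
  hockey-stick m zero    = trans (binom[n+0]n≈1 m) (sym (binom[n+0]n≈1 (suc m)))
  hockey-stick m (suc n) = begin
    sumTo (suc n) (λ i → binom (m ℕ.+ (suc n ∸ i)) m)               ≈⟨ sumTo-unfoldˡ n _ ⟩
    binom (m ℕ.+ suc n) m + sumTo n (λ i → binom (m ℕ.+ (n ∸ i)) m) ≈⟨ +-congˡ (hockey-stick m n) ⟩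
    binom (m ℕ.+ suc n) m + binom (suc m ℕ.+ n) (suc m)             ≈⟨ +-congˡ (fromℕ-cong (≡.cong (_C suc m) (≡.sym (ℕ.+-suc m n)))) ⟩
    binom (m ℕ.+ suc n) m + binom (m ℕ.+ suc n) (suc m)             ≈⟨ binom-pascal (m ℕ.+ suc n) m ⟨
    binom (suc m ℕ.+ suc n) (suc m)                                 ∎

  -- Multiplication by 1 - t and by t on coefficient sequences
  infix 4 _≋_
  _≋_ : Series → Series → Set ℓ
  u ≋ v = ∀ m → u m ≈ v m

  1ₛ : Series
  1ₛ zero    = 1#
  1ₛ (suc _) = 0#

  ∇ : Series → Series
  ∇ u zero    = u 0
  ∇ u (suc k) = u (suc k) - u k

  ∇[_] : ℕ → Series → Series
  ∇[ zero  ] u = u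
  ∇[ suc p ] u = ∇ (∇[ p ] u)

  shift : Series → Series
  shift u zero    = 0#
  shift u (suc m) = u m

  shift[_] : ℕ → Series → Series
  shift[ zero  ] u = u
  shift[ suc k ] u = shift (shift[ k ] u)

  ∇-cong : ∀ {u v} → u ≋ v → ∇ u ≋ ∇ v
  ∇-cong u≋v zero    = u≋v 0
  ∇-cong u≋v (suc k) = +-cong (u≋v (suc k)) (-‿cong (u≋v k))

  ∇[]-cong : ∀ p {u v} → u ≋ v → ∇[ p ] u ≋ ∇[ p ] v
  ∇[]-cong zero    u≋v = u≋v
  ∇[]-cong (suc p) u≋v = ∇-cong (∇[]-cong p u≋v)

  ∇[]-sucʳ : ∀ p u → ∇[ suc p ] u ≋ ∇[ p ] (∇ u)
  ∇[]-sucʳ zero    u m = refl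
  ∇[]-sucʳ (suc p) u   = ∇-cong (∇[]-sucʳ p u)

  ∇[]-+ : ∀ p q u → ∇[ p ℕ.+ q ] u ≋ ∇[ p ] (∇[ q ] u)
  ∇[]-+ zero    q u m = refl
  ∇[]-+ (suc p) q u   = ∇-cong (∇[]-+ p q u)

  ∇[]-*ˡ : ∀ p x u → ∇[ p ] (λ m → x * u m) ≋ (λ m → x * ∇[ p ] u m)
  ∇[]-*ˡ zero    x u m = refl
  ∇[]-*ˡ (suc p) x u m = trans (∇-cong (∇[]-*ˡ p x u) m) (∇-*ˡ (∇[ p ] u) m)
    where
    ∇-*ˡ : ∀ u → ∇ (λ m → x * u m) ≋ (λ m → x * ∇ u m)
    ∇-*ˡ u zero    = refl
    ∇-*ˡ u (suc k) = trans (+-congˡ (-‿distribʳ-* x (u k))) (sym (distribˡ x _ _))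

  ∇[]-sumTo : ∀ p n (F : ℕ → Series) → ∇[ p ] (λ m → sumTo n (λ k → F k m)) ≋ (λ m → sumTo n (λ k → ∇[ p ] (F k) m))
  ∇[]-sumTo zero    n F m = refl
  ∇[]-sumTo (suc p) n F m = trans (∇-cong (∇[]-sumTo p n F) m) (∇-sumTo (λ k → ∇[ p ] (F k)) m)
    where
    ∇-sumTo : ∀ (F : ℕ → Series) → ∇ (λ m → sumTo n (λ k → F k m)) ≋ (λ m → sumTo n (λ k → ∇ (F k) m))
    ∇-sumTo F zero    = refl
    ∇-sumTo F (suc m) = trans (+-congˡ (sumTo-neg n _)) (sym (sumTo-+ n _ _))

  ∇[]-+ₛ : ∀ p u v → ∇[ p ] (λ m → u m + v m) ≋ (λ m → ∇[ p ] u m + ∇[ p ] v m)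
  ∇[]-+ₛ zero    u v m = refl
  ∇[]-+ₛ (suc p) u v m = trans (∇-cong (∇[]-+ₛ p u v) m) (∇-+ₛ (∇[ p ] u) (∇[ p ] v) m)
    where
    ∇-+ₛ : ∀ u v → ∇ (λ m → u m + v m) ≋ (λ m → ∇ u m + ∇ v m)
    ∇-+ₛ u v zero    = refl
    ∇-+ₛ u v (suc k) = trans (+-congˡ (-‿+-distrib _ _)) (interchange _ _ _ _)

  shift-cong : ∀ {u v} → u ≋ v → shift u ≋ shift v
  shift-cong u≋v zero    = refl
  shift-cong u≋v (suc m) = u≋v m

  shift[]-cong : ∀ k {u v} → u ≋ v → shift[ k ] u ≋ shift[ k ] v
  shift[]-cong zero    u≋v = u≋v
  shift[]-cong (suc k) u≋v = shift-cong (shift[]-cong k u≋v)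

  ∇[]-shift[] : ∀ p k u → ∇[ p ] (shift[ k ] u) ≋ shift[ k ] (∇[ p ] u)
  ∇[]-shift[] p zero    u m = refl
  ∇[]-shift[] p (suc k) u m = trans (∇[]-shift p (shift[ k ] u) m) (shift-cong (∇[]-shift[] p k u) m)
    where
    ∇-shift : ∀ u → ∇ (shift u) ≋ shift (∇ u)
    ∇-shift u zero          = refl
    ∇-shift u (suc zero)    = trans (+-congˡ ε⁻¹≈ε) (+-identityʳ (u 0))
    ∇-shift u (suc (suc k)) = refl
    ∇[]-shift : ∀ p u → ∇[ p ] (shift u) ≋ shift (∇[ p ] u)
    ∇[]-shift zero    u m = refl
    ∇[]-shift (suc p) u m = trans (∇-cong (∇[]-shift p u) m) (∇-shift (∇[ p ] u) m)

  shift[]-≥ : ∀ k u d → shift[ k ] u (k ℕ.+ d) ≈ u d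
  shift[]-≥ zero    u d = refl
  shift[]-≥ (suc k) u d = shift[]-≥ k u d

  shift[]-< : ∀ k u m → m ℕ.< k → shift[ k ] u m ≈ 0#
  shift[]-< (suc k) u zero    _         = refl
  shift[]-< (suc k) u (suc m) (s≤s m<k) = shift[]-< k u m m<k

  ∇[]-expansion : ∀ p u k → ∇[ p ] u k ≈ sumTo k (λ j → binom p j * (sign j * u (k ∸ j)))
  ∇[]-expansion zero u zero    = sym (trans (*-congʳ (binom-diag 0)) (trans (*-identityˡ _) (*-identityˡ _)))
  ∇[]-expansion zero u (suc k) = sym (begin
    sumTo (suc k) (λ j → binom 0 j * (sign j * u (suc k ∸ j)))
      ≈⟨ sumTo-unfoldˡ k _ ⟩
    binom 0 0 * (1# * u (suc k)) + sumTo k (λ j → binom 0 (suc j) * (sign (suc j) * u (k ∸ j)))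
      ≈⟨ +-congˡ (sumTo-zero k _ (λ j _ → zeroˡ _)) ⟩
    binom 0 0 * (1# * u (suc k)) + 0#
      ≈⟨ trans (+-identityʳ _) (trans (*-congʳ (binom-diag 0)) (trans (*-identityˡ _) (*-identityˡ _))) ⟩
    u (suc k) ∎)
  ∇[]-expansion (suc p) u zero    = ∇[]-expansion p u zero
  ∇[]-expansion (suc p) u (suc k) = sym (begin
    sumTo (suc k) (λ j → binom (suc p) j * (sign j * u (suc k ∸ j)))
      ≈⟨ sumTo-pascal p k _ ⟩
    sumTo k (λ j → binom p j * (sign (suc j) * u (k ∸ j))) + E (suc k)
      ≈⟨ +-congʳ (trans (sumTo-cong k (λ j _ → trans (*-congˡ (sym (-‿distribˡ-* _ _))) (sym (-‿distribʳ-* _ _)))) (sym (sumTo-neg k _))) ⟩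
    - E k + E (suc k)
      ≈⟨ +-comm _ _ ⟩
    E (suc k) - E k
      ≈⟨ +-cong (∇[]-expansion p u (suc k)) (-‿cong (∇[]-expansion p u k)) ⟨
    ∇[ suc p ] u (suc k) ∎)
    where
    E : ℕ → Carrier
    E k = sumTo k (λ j → binom p j * (sign j * u (k ∸ j)))

  ∇[]-1ₛ : ∀ r l → ∇[ r ] 1ₛ l ≈ sign l * binom r l
  ∇[]-1ₛ r l = begin
    ∇[ r ] 1ₛ l                                       ≈⟨ ∇[]-expansion r 1ₛ l ⟩
    sumTo l (λ j → binom r j * (sign j * 1ₛ (l ∸ j))) ≈⟨ sumTo-last l _ (λ j j<l → below-l j<l) ⟩
    binom r l * (sign l * 1ₛ (l ∸ l))                 ≈⟨ *-congˡ (*-congˡ (reflexive (≡.cong 1ₛ (ℕ.n∸n≡0 l)))) ⟩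
    binom r l * (sign l * 1#)                         ≈⟨ *-congˡ (*-identityʳ _) ⟩
    binom r l * sign l                                ≈⟨ *-comm _ _ ⟩
    sign l * binom r l                                ∎
    where
    1ₛ-pos : ∀ {x} → 0 ℕ.< x → 1ₛ x ≈ 0#
    1ₛ-pos {suc x} _ = refl
    below-l : ∀ {j} → j ℕ.< l → binom r j * (sign j * 1ₛ (l ∸ j)) ≈ 0#
    below-l j<l = trans (*-congˡ (trans (*-congˡ (1ₛ-pos (ℕ.m<n⇒0<n∸m j<l))) (zeroʳ _))) (zeroʳ _)

  -- the coefficients of (1 - t) ^ -(q+1)
  binomSeq : ℕ → Series
  binomSeq q m = binom (q ℕ.+ m) q

  ∇[1+q]-binomSeq : ∀ q → ∇[ suc q ] (binomSeq q) ≋ 1ₛ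
  ∇[1+q]-binomSeq zero zero        = +-identityʳ 1#
  ∇[1+q]-binomSeq zero (suc m)     = -‿inverseʳ _
  ∇[1+q]-binomSeq (suc q) m = begin
    ∇[ suc (suc q) ] (binomSeq (suc q)) m ≈⟨ ∇[]-sucʳ (suc q) _ m ⟩
    ∇[ suc q ] (∇ (binomSeq (suc q))) m   ≈⟨ ∇[]-cong (suc q) ∇-binomSeq m ⟩
    ∇[ suc q ] (binomSeq q) m             ≈⟨ ∇[1+q]-binomSeq q m ⟩
    1ₛ m                                  ∎
    where
    ∇-binomSeq : ∇ (binomSeq (suc q)) ≋ binomSeq q
    ∇-binomSeq zero    = trans (binom[n+0]n≈1 (suc q)) (sym (binom[n+0]n≈1 q))
    ∇-binomSeq (suc m) = x≈y+z⇒x-z≈y (begin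
      binom (suc q ℕ.+ suc m) (suc q)                     ≈⟨ fromℕ-cong (≡.cong (_C suc q) (ℕ.+-suc (suc q) m)) ⟩
      binom (suc (suc q ℕ.+ m)) (suc q)                   ≈⟨ binom-pascal (suc q ℕ.+ m) q ⟩
      binom (suc q ℕ.+ m) q + binom (suc q ℕ.+ m) (suc q) ≈⟨ +-congʳ (fromℕ-cong (≡.cong (_C q) (≡.sym (ℕ.+-suc q m)))) ⟩
      binom (q ℕ.+ suc m) q + binom (suc q ℕ.+ m) (suc q) ∎)

  ∇[]-binomSeq : ∀ {p} r q → p ≡ r ℕ.+ suc q → ∇[ p ] (binomSeq q) ≋ (λ l → sign l * binom r l)
  ∇[]-binomSeq r q ≡.refl l = begin
    ∇[ r ℕ.+ suc q ] (binomSeq q) l    ≈⟨ ∇[]-+ r (suc q) _ l ⟩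
    ∇[ r ] (∇[ suc q ] (binomSeq q)) l ≈⟨ ∇[]-cong r (∇[1+q]-binomSeq q) l ⟩
    ∇[ r ] 1ₛ l                        ≈⟨ ∇[]-1ₛ r l ⟩
    sign l * binom r l                 ∎

  -- Powers of series that are geometric up to some degree
  ^-homo-* : ∀ φ i j → φ ^ (i ℕ.+ j) ≈ φ ^ i * φ ^ j
  ^-homo-* φ zero    j = sym (*-identityˡ _)
  ^-homo-* φ (suc i) j = trans (*-congˡ (^-homo-* φ i j)) (sym (*-assoc _ _ _))

  -- the coefficients of (1 - φ x) ^ -(m+1)
  negBinomial : ℕ → Carrier → Series
  negBinomial m φ j = binom (m ℕ.+ j) m * φ ^ j

  negBinomial-0 : ∀ m φ → negBinomial m φ 0 ≈ 1#
  negBinomial-0 m φ = trans (*-identityʳ _) (binom[n+0]n≈1 m)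

  ⊛-^ₛ0 : ∀ (f g : Series) k → (f ⊛ (g ^ₛ 0)) k ≈ f k
  ⊛-^ₛ0 f g k = trans (sumTo-last k _ below-k) (trans (*-congˡ (reflexive (≡.cong (g ^ₛ 0) (ℕ.n∸n≡0 k)))) (*-identityʳ _))
    where
    below-k : ∀ j → j ℕ.< k → f j * (g ^ₛ 0) (k ∸ j) ≈ 0#
    below-k j j<k with k ∸ j | ℕ.m<n⇒0<n∸m j<k
    ... | suc _ | _ = zeroʳ _

  ⊛-negBinomial : ∀ {a b : Series} φ m k → (∀ i → i ℕ.≤ k → a i ≈ φ ^ i) → (∀ j → j ℕ.≤ k → b j ≈ negBinomial m φ j) →
                  (a ⊛ b) k ≈ negBinomial (suc m) φ k
  ⊛-negBinomial {a} {b} φ m k a≈ b≈ = begin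
    sumTo k (λ i → a i * b (k ∸ i))                 ≈⟨ sumTo-cong k term ⟩
    sumTo k (λ i → φ ^ k * binom (m ℕ.+ (k ∸ i)) m) ≈⟨ sumTo-*ˡ k (φ ^ k) _ ⟨
    φ ^ k * sumTo k (λ i → binom (m ℕ.+ (k ∸ i)) m) ≈⟨ *-congˡ (hockey-stick m k) ⟩
    φ ^ k * binom (suc m ℕ.+ k) (suc m)             ≈⟨ *-comm _ _ ⟩
    negBinomial (suc m) φ k                         ∎
    where
    term : ∀ i → i ℕ.≤ k → a i * b (k ∸ i) ≈ φ ^ k * binom (m ℕ.+ (k ∸ i)) m
    term i i≤k = begin
      a i * b (k ∸ i)                                 ≈⟨ *-cong (a≈ i i≤k) (b≈ (k ∸ i) (ℕ.m∸n≤m k i)) ⟩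
      φ ^ i * (binom (m ℕ.+ (k ∸ i)) m * φ ^ (k ∸ i)) ≈⟨ *-congˡ (*-comm _ _) ⟩
      φ ^ i * (φ ^ (k ∸ i) * binom (m ℕ.+ (k ∸ i)) m) ≈⟨ *-assoc _ _ _ ⟨
      (φ ^ i * φ ^ (k ∸ i)) * binom (m ℕ.+ (k ∸ i)) m ≈⟨ *-congʳ (^-homo-* φ i (k ∸ i)) ⟨
      φ ^ (i ℕ.+ (k ∸ i)) * binom (m ℕ.+ (k ∸ i)) m   ≈⟨ *-congʳ (reflexive (≡.cong (φ ^_) (ℕ.m+[n∸m]≡n i≤k))) ⟩
      φ ^ k * binom (m ℕ.+ (k ∸ i)) m                 ∎

  ^ₛ-geometric : ∀ {a : Series} {φ n} → (∀ i → i ℕ.≤ n → a i ≈ φ ^ i) →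
                 ∀ m k → k ℕ.≤ n → (a ^ₛ suc m) k ≈ negBinomial m φ k
  ^ₛ-geometric {a} a≈ zero    k k≤n = trans (⊛-^ₛ0 a a k) (trans (a≈ k k≤n) (sym (trans (*-congʳ (+-identityʳ 1#)) (*-identityˡ _))))
  ^ₛ-geometric {a} a≈ (suc m) k k≤n =
    ⊛-negBinomial _ m k (λ i i≤k → a≈ i (ℕ.≤-trans i≤k k≤n)) (λ j j≤k → ^ₛ-geometric a≈ m j (ℕ.≤-trans j≤k k≤n))

  sumTo-differAtEnds : ∀ n (f g : ℕ → Carrier) {x y} → f 0 ≈ g 0 + x → (∀ i → 0 ℕ.< i → i ℕ.≤ n → f i ≈ g i) →
                       f (suc n) ≈ g (suc n) + y → sumTo (suc n) f ≈ sumTo (suc n) g + (x + y)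
  sumTo-differAtEnds n f g {x} {y} f0≈ f≈g fn≈ = begin
    sumTo n f + f (suc n)             ≈⟨ +-cong (differAtFirst n (λ i 0<i i≤n → f≈g i 0<i i≤n)) fn≈ ⟩
    (sumTo n g + x) + (g (suc n) + y) ≈⟨ interchange _ _ _ _ ⟩
    sumTo (suc n) g + (x + y)         ∎
    where
    differAtFirst : ∀ k → (∀ i → 0 ℕ.< i → i ℕ.≤ k → f i ≈ g i) → sumTo k f ≈ sumTo k g + x
    differAtFirst zero    _   = f0≈
    differAtFirst (suc k) f≈g = begin
      sumTo k f + f (suc k)       ≈⟨ +-cong (differAtFirst k (λ i 0<i i≤k → f≈g i 0<i (ℕ.m≤n⇒m≤1+n i≤k))) (f≈g (suc k) (s≤s z≤n) ℕ.≤-refl) ⟩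
      (sumTo k g + x) + g (suc k) ≈⟨ +-assoc _ _ _ ⟩
      sumTo k g + (x + g (suc k)) ≈⟨ +-congˡ (+-comm _ _) ⟩
      sumTo k g + (g (suc k) + x) ≈⟨ +-assoc _ _ _ ⟨
      sumTo (suc k) g + x         ∎

  ^ₛ-perturbed : ∀ {a : Series} {φ} n → a 0 ≈ 1# → (∀ i → i ℕ.≤ n → a i ≈ φ ^ i) → ∀ m →
                 (a ^ₛ suc m) (suc n) ≈ negBinomial m φ (suc n) + fromℕ (suc m) * (a (suc n) - φ ^ suc n)
  ^ₛ-perturbed {a} {φ} n a0≈1 a≈ zero = begin
    (a ^ₛ 1) (suc n) ≈⟨ ⊛-^ₛ0 a a (suc n) ⟩
    a (suc n)        ≈⟨ x≈y+[x-y] _ _ ⟩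
    φ ^ suc n + ε                                 ≈⟨ +-cong (sym (trans (*-congʳ (+-identityʳ 1#)) (*-identityˡ _)))
                                                            (sym (trans (*-congʳ (+-identityʳ 1#)) (*-identityˡ _))) ⟩
    negBinomial 0 φ (suc n) + fromℕ 1 * ε         ∎
    where ε = a (suc n) - φ ^ suc n
  ^ₛ-perturbed {a} {φ} n a0≈1 a≈ (suc m) = begin
    sumTo (suc n) (λ i → a i * b (suc n ∸ i))
      ≈⟨ sumTo-differAtEnds n _ g first middle last ⟩
    sumTo (suc n) g + (fromℕ (suc m) * ε + ε)
      ≈⟨ +-cong (⊛-negBinomial φ m (suc n) (λ _ _ → refl) (λ _ _ → refl)) (+-comm _ _) ⟩
    negBinomial (suc m) φ (suc n) + (ε + fromℕ (suc m) * ε)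
      ≈⟨ +-congˡ (+-congʳ (*-identityˡ ε)) ⟨
    negBinomial (suc m) φ (suc n) + (1# * ε + fromℕ (suc m) * ε)
      ≈⟨ +-congˡ (distribʳ ε 1# (fromℕ (suc m))) ⟨
    negBinomial (suc m) φ (suc n) + fromℕ (suc (suc m)) * ε ∎
    where
    ε = a (suc n) - φ ^ suc n
    b = a ^ₛ suc m
    g : ℕ → Carrier
    g i = φ ^ i * negBinomial m φ (suc n ∸ i)
    first : a 0 * b (suc n) ≈ g 0 + fromℕ (suc m) * ε
    first = begin
      a 0 * b (suc n)                                         ≈⟨ *-cong a0≈1 (^ₛ-perturbed n a0≈1 a≈ m) ⟩
      1# * (negBinomial m φ (suc n) + fromℕ (suc m) * ε)      ≈⟨ distribˡ _ _ _ ⟩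
      1# * negBinomial m φ (suc n) + 1# * (fromℕ (suc m) * ε) ≈⟨ +-congˡ (*-identityˡ _) ⟩
      g 0 + fromℕ (suc m) * ε                                 ∎
    middle : ∀ i → 0 ℕ.< i → i ℕ.≤ n → a i * b (suc n ∸ i) ≈ g i
    middle i 0<i i≤n = *-cong (a≈ i i≤n) (^ₛ-geometric a≈ m (suc n ∸ i) (ℕ.∸-monoʳ-≤ (suc n) 0<i))
    last : a (suc n) * b (suc n ∸ suc n) ≈ g (suc n) + ε
    last = begin
      a (suc n) * b (n ∸ n)                     ≈⟨ *-cong (x≈y+[x-y] _ _) (^ₛ-geometric a≈ m (n ∸ n) (ℕ.m∸n≤m n n)) ⟩
      (φ ^ suc n + ε) * negBinomial m φ (n ∸ n) ≈⟨ distribʳ _ _ _ ⟩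
      g (suc n) + ε * negBinomial m φ (n ∸ n)   ≈⟨ +-congˡ (*-congˡ (reflexive (≡.cong (negBinomial m φ) (ℕ.n∸n≡0 n)))) ⟩
      g (suc n) + ε * negBinomial m φ 0         ≈⟨ +-congˡ (trans (*-congˡ (negBinomial-0 m φ)) (*-identityʳ ε)) ⟩
      g (suc n) + ε                             ∎

  -- Numerator polynomials of a geometric series
  fromℕ-*-≡ : ∀ a b c d → a ℕ.* b ≡ c ℕ.* d → fromℕ a * fromℕ b ≈ fromℕ c * fromℕ d
  fromℕ-*-≡ a b c d ab≡cd = trans (sym (fromℕ-* a b)) (trans (fromℕ-cong ab≡cd) (fromℕ-* c d))

  binom[n+m][n+k]≈shift[k] : ∀ n k → (λ m → binom (n ℕ.+ m) (n ℕ.+ k)) ≋ shift[ k ] (binomSeq (n ℕ.+ k))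
  binom[n+m][n+k]≈shift[k] n k m with k ℕ.≤? m
  ... | yes k≤m with ℕ.m≤n⇒∃[o]m+o≡n k≤m
  ...   | d , ≡.refl = trans (fromℕ-cong (≡.cong (_C (n ℕ.+ k)) (≡.sym (ℕ.+-assoc n k d)))) (sym (shift[]-≥ k _ d))
  binom[n+m][n+k]≈shift[k] n k m | no k≰m =
    trans (binom-zero (ℕ.+-monoʳ-< n (ℕ.≰⇒> k≰m))) (sym (shift[]-< k _ m (ℕ.≰⇒> k≰m)))

  binomSeq² : ℕ → Series
  binomSeq² n m = binom (n ℕ.+ m) n * binom (n ℕ.+ m) n

  binomSeq²-decomposition : ∀ n m → binomSeq² n m ≈ sumTo n (λ k → (binom n k * binom (n ℕ.+ k) k) * binom (n ℕ.+ m) (n ℕ.+ k))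
  binomSeq²-decomposition n m = begin
    binom (n ℕ.+ m) n * binom (n ℕ.+ m) n
      ≈⟨ *-congˡ (trans (fromℕ-cong (≡.cong ((n ℕ.+ m) C_) (≡.sym (ℕ.+-identityʳ n)))) (sym (vandermonde n m 0))) ⟩
    binom (n ℕ.+ m) n * sumTo n (λ k → binom n k * binom m (k ℕ.+ 0))
      ≈⟨ sumTo-*ˡ n _ _ ⟩
    sumTo n (λ k → binom (n ℕ.+ m) n * (binom n k * binom m (k ℕ.+ 0)))
      ≈⟨ sumTo-cong n (λ k _ → term k) ⟩
    sumTo n (λ k → (binom n k * binom (n ℕ.+ k) k) * binom (n ℕ.+ m) (n ℕ.+ k)) ∎
    where
    term : ∀ k → binom (n ℕ.+ m) n * (binom n k * binom m (k ℕ.+ 0))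
                 ≈ (binom n k * binom (n ℕ.+ k) k) * binom (n ℕ.+ m) (n ℕ.+ k)
    term k = begin
      binom (n ℕ.+ m) n * (binom n k * binom m (k ℕ.+ 0))         ≈⟨ *-congˡ (*-congˡ (fromℕ-cong (≡.cong (m C_) (ℕ.+-identityʳ k)))) ⟩
      binom (n ℕ.+ m) n * (binom n k * binom m k)                 ≈⟨ x*[y*z]≈y*[x*z] _ _ _ ⟩
      binom n k * (binom (n ℕ.+ m) n * binom m k)                 ≈⟨ *-congˡ (fromℕ-*-≡ ((n ℕ.+ m) C n) (m C k) ((n ℕ.+ k) C k) ((n ℕ.+ m) C (n ℕ.+ k)) ([n+m]Cn*mCk≡[n+k]Ck*[n+m]C[n+k] n m k)) ⟩
      binom n k * (binom (n ℕ.+ k) k * binom (n ℕ.+ m) (n ℕ.+ k)) ≈⟨ *-assoc _ _ _ ⟨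
      (binom n k * binom (n ℕ.+ k) k) * binom (n ℕ.+ m) (n ℕ.+ k) ∎

  ∇[]-binom[n+m][n+k] : ∀ {n k} → k ℕ.≤ n →
    ∇[ 2 ℕ.* n ℕ.+ 1 ] (λ m → binom (n ℕ.+ m) (n ℕ.+ k)) ≋ shift[ k ] (λ j → sign j * binom (n ∸ k) j)
  ∇[]-binom[n+m][n+k] {n} {k} k≤n l = begin
    ∇[ 2 ℕ.* n ℕ.+ 1 ] (λ m → binom (n ℕ.+ m) (n ℕ.+ k)) l ≈⟨ ∇[]-cong (2 ℕ.* n ℕ.+ 1) (binom[n+m][n+k]≈shift[k] n k) l ⟩
    ∇[ 2 ℕ.* n ℕ.+ 1 ] (shift[ k ] (binomSeq (n ℕ.+ k))) l ≈⟨ ∇[]-shift[] (2 ℕ.* n ℕ.+ 1) k _ l ⟩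
    shift[ k ] (∇[ 2 ℕ.* n ℕ.+ 1 ] (binomSeq (n ℕ.+ k))) l ≈⟨ shift[]-cong k ∇[2n+1]-binomSeq l ⟩
    shift[ k ] (λ j → sign j * binom (n ∸ k) j) l          ∎
    where
    2n+1≡[n∸k]+[1+n+k] : 2 ℕ.* n ℕ.+ 1 ≡ (n ∸ k) ℕ.+ suc (n ℕ.+ k)
    2n+1≡[n∸k]+[1+n+k] with ℕ.m≤n⇒∃[o]m+o≡n k≤n
    ... | d , ≡.refl rewrite ℕ.m+n∸m≡n k d = 2[k+d]+1≡d+[1+[k+d]+k] k d
      where
      2[k+d]+1≡d+[1+[k+d]+k] : ∀ k d → 2 ℕ.* (k ℕ.+ d) ℕ.+ 1 ≡ d ℕ.+ suc ((k ℕ.+ d) ℕ.+ k)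
      2[k+d]+1≡d+[1+[k+d]+k] = solve-∀
    ∇[2n+1]-binomSeq : ∇[ 2 ℕ.* n ℕ.+ 1 ] (binomSeq (n ℕ.+ k)) ≋ (λ j → sign j * binom (n ∸ k) j)
    ∇[2n+1]-binomSeq = ∇[]-binomSeq (n ∸ k) (n ℕ.+ k) 2n+1≡[n∸k]+[1+n+k]

  -- [t^l] Σ_k C(n,k) C(n+k,k) t^k (1 - t)^(n-k)  =  C(n,l)²
  squaredBinomial-identity : ∀ n l →
    sumTo n (λ k → (binom n k * binom (n ℕ.+ k) k) * shift[ k ] (λ j → sign j * binom (n ∸ k) j) l) ≈ binom n l * binom n l
  squaredBinomial-identity n l = begin
    sumTo n T ≈⟨ restrict-to-l ⟩
    sumTo l T ≈⟨ sumTo-cong l term ⟩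
    sumTo l (λ k → binom n l * (binom l k * (sign (l ∸ k) * binom (n ℕ.+ k) k)))
                                                                      ≈⟨ sumTo-*ˡ l (binom n l) _ ⟨
    binom n l * sumTo l (λ k → binom l k * (sign (l ∸ k) * binom (n ℕ.+ k) k))
                                                                      ≈⟨ *-congˡ (alternating-binom-sum l n 0) ⟩
    binom n l * binom n l                                             ∎
    where
    T : ℕ → Carrier
    T k = (binom n k * binom (n ℕ.+ k) k) * shift[ k ] (λ j → sign j * binom (n ∸ k) j) l
    restrict-to-l : sumTo n T ≈ sumTo l T
    restrict-to-l with n ℕ.≤? l
    ... | yes n≤l = sym (sumTo-truncate T n≤l (λ k n<k → trans (*-congʳ (trans (*-congʳ (binom-zero n<k)) (zeroˡ _))) (zeroˡ _)))
    ... | no  n≰l = sumTo-truncate T (ℕ.<⇒≤ (ℕ.≰⇒> n≰l)) (λ k l<k → trans (*-congˡ (shift[]-< k _ l l<k)) (zeroʳ _))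
    term : ∀ k → k ℕ.≤ l → T k ≈ binom n l * (binom l k * (sign (l ∸ k) * binom (n ℕ.+ k) k))
    term k k≤l = begin
      (binom n k * binom (n ℕ.+ k) k) * shift[ k ] (λ j → sign j * binom (n ∸ k) j) l
        ≈⟨ *-congˡ (trans (reflexive (≡.cong (shift[ k ] _) (≡.sym (ℕ.m+[n∸m]≡n k≤l)))) (shift[]-≥ k _ (l ∸ k))) ⟩
      (binom n k * binom (n ℕ.+ k) k) * (sign (l ∸ k) * binom (n ∸ k) (l ∸ k))
        ≈⟨ trans (*-congˡ (*-comm _ _)) (*-interchange _ _ _ _) ⟩
      (binom n k * binom (n ∸ k) (l ∸ k)) * (binom (n ℕ.+ k) k * sign (l ∸ k))
        ≈⟨ *-cong (fromℕ-*-≡ (n C k) ((n ∸ k) C (l ∸ k)) (n C l) (l C k) (nCk*[n∸k]C[l∸k]≡nCl*lCk n k≤l)) (*-comm _ _) ⟩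
      (binom n l * binom l k) * (sign (l ∸ k) * binom (n ℕ.+ k) k)
        ≈⟨ *-assoc _ _ _ ⟩
      binom n l * (binom l k * (sign (l ∸ k) * binom (n ℕ.+ k) k)) ∎

  ∇[]-binomSeq² : ∀ n l → ∇[ 2 ℕ.* n ℕ.+ 1 ] (binomSeq² n) l ≈ binom n l * binom n l
  ∇[]-binomSeq² n l = begin
    ∇[ p ] (binomSeq² n) l                                                 ≈⟨ ∇[]-cong p (binomSeq²-decomposition n) l ⟩
    ∇[ p ] (λ m → sumTo n (λ k → coef k * binom (n ℕ.+ m) (n ℕ.+ k))) l    ≈⟨ ∇[]-sumTo p n _ l ⟩
    sumTo n (λ k → ∇[ p ] (λ m → coef k * binom (n ℕ.+ m) (n ℕ.+ k)) l)    ≈⟨ sumTo-cong n ∇[]-term ⟩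
    sumTo n (λ k → coef k * shift[ k ] (λ j → sign j * binom (n ∸ k) j) l) ≈⟨ squaredBinomial-identity n l ⟩
    binom n l * binom n l                                                  ∎
    where
    p = 2 ℕ.* n ℕ.+ 1
    coef : ℕ → Carrier
    coef k = binom n k * binom (n ℕ.+ k) k
    ∇[]-term : ∀ k → k ℕ.≤ n → ∇[ p ] (λ m → coef k * binom (n ℕ.+ m) (n ℕ.+ k)) l
                                 ≈ coef k * shift[ k ] (λ j → sign j * binom (n ∸ k) j) l
    ∇[]-term k k≤n = trans (∇[]-*ˡ p (coef k) _ l) (*-congˡ (∇[]-binom[n+m][n+k] k≤n l))

  numerator≈∇[2n+1]diag : ∀ a n → numerator a n ≋ ∇[ 2 ℕ.* n ℕ.+ 1 ] (diag a n)
  numerator≈∇[2n+1]diag a n k = sym (trans (∇[]-expansion (2 ℕ.* n ℕ.+ 1) (diag a n) k)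
                                           (sumTo-cong k (λ j _ → x*[y*z]≈y*[x*z] _ _ _)))

  fallingRatio*negBinomial : ∀ φ n m → fromℕ (fallingRatio n m) * negBinomial m φ n ≈ φ ^ n * (fromℕ (n !) * binomSeq² n m)
  fallingRatio*negBinomial φ n m = begin
    fromℕ ((n ℕ.+ m) P n) * (binom (m ℕ.+ n) m * φ ^ n)           ≈⟨ *-assoc _ _ _ ⟨
    (fromℕ ((n ℕ.+ m) P n) * binom (m ℕ.+ n) m) * φ ^ n           ≈⟨ *-congʳ (fromℕ-*-≡ ((n ℕ.+ m) P n) ((m ℕ.+ n) C m) (n !) (((n ℕ.+ m) C n) ℕ.* ((n ℕ.+ m) C n))
                                                                             ([n+m]Pn*[m+n]Cm≡n!*[n+m]Cn² n m)) ⟩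
    (fromℕ (n !) * fromℕ (((n ℕ.+ m) C n) ℕ.* ((n ℕ.+ m) C n))) * φ ^ n
                                                                  ≈⟨ *-congʳ (*-congˡ (fromℕ-* ((n ℕ.+ m) C n) ((n ℕ.+ m) C n))) ⟩
    (fromℕ (n !) * binomSeq² n m) * φ ^ n ≈⟨ *-comm _ _ ⟩
    φ ^ n * (fromℕ (n !) * binomSeq² n m) ∎

  diag-geometric : ∀ {a : Series} {φ n} → (∀ i → i ℕ.≤ n → a i ≈ φ ^ i) →
                   diag a n ≋ (λ m → φ ^ n * (fromℕ (n !) * binomSeq² n m))
  diag-geometric {a} {φ} {n} a≈ m =
    trans (*-congˡ (^ₛ-geometric a≈ m n ℕ.≤-refl)) (fallingRatio*negBinomial φ n m)

  numerator-geometric : ∀ {a : Series} {φ n} → (∀ i → i ℕ.≤ n → a i ≈ φ ^ i) →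
                        numerator a n ≋ (λ l → φ ^ n * (fromℕ (n !) * (binom n l * binom n l)))
  numerator-geometric {a} {φ} {n} a≈ l = begin
    numerator a n l                                        ≈⟨ numerator≈∇[2n+1]diag a n l ⟩
    ∇[ p ] (diag a n) l                                    ≈⟨ ∇[]-cong p (diag-geometric a≈) l ⟩
    ∇[ p ] (λ m → φ ^ n * (fromℕ (n !) * binomSeq² n m)) l ≈⟨ ∇[]-*ˡ p (φ ^ n) _ l ⟩
    φ ^ n * ∇[ p ] (λ m → fromℕ (n !) * binomSeq² n m) l   ≈⟨ *-congˡ (∇[]-*ˡ p (fromℕ (n !)) _ l) ⟩
    φ ^ n * (fromℕ (n !) * ∇[ p ] (binomSeq² n) l)         ≈⟨ *-congˡ (*-congˡ (∇[]-binomSeq² n l)) ⟩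
    φ ^ n * (fromℕ (n !) * (binom n l * binom n l))        ∎
    where p = 2 ℕ.* n ℕ.+ 1

  backward : ∀ (a : Series) → (∃ λ φ → ∀ n → a n ≈ geometric φ n) → ∀ n → SymmetricOfDegree n (numerator a n)
  backward a (φ , a≈) n = palindromic , vanishing
    where
    h : numerator a n ≋ (λ l → φ ^ n * (fromℕ (n !) * (binom n l * binom n l)))
    h = numerator-geometric (λ i _ → a≈ i)
    palindromic : ∀ k → k ℕ.≤ n → numerator a n k ≈ numerator a n (n ∸ k)
    palindromic k k≤n = begin
      numerator a n k                                              ≈⟨ h k ⟩
      φ ^ n * (fromℕ (n !) * (binom n k * binom n k))               ≈⟨ reflexive (≡.cong (λ j → φ ^ n * (fromℕ (n !) * (fromℕ j * fromℕ j)))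
                                                                                        (nCk≡nC[n∸k] k≤n)) ⟩
      φ ^ n * (fromℕ (n !) * (binom n (n ∸ k) * binom n (n ∸ k))) ≈⟨ h (n ∸ k) ⟨
      numerator a n (n ∸ k)                                       ∎
    vanishing : ∀ k → n ℕ.< k → numerator a n k ≈ 0#
    vanishing k n<k = begin
      numerator a n k                                 ≈⟨ h k ⟩
      φ ^ n * (fromℕ (n !) * (binom n k * binom n k)) ≈⟨ *-congˡ (*-congˡ (trans (*-congˡ (binom-zero n<k)) (zeroʳ _))) ⟩
      φ ^ n * (fromℕ (n !) * 0#)                      ≈⟨ trans (*-congˡ (zeroʳ _)) (zeroʳ _) ⟩
      0#                                              ∎

  -- A perturbation of a geometric series
  perturbationDiag : ℕ → Series
  perturbationDiag N m = fromℕ (fallingRatio N m ℕ.* suc m)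

  diag-perturbed : ∀ {a : Series} {φ} n → a 0 ≈ 1# → (∀ i → i ℕ.≤ n → a i ≈ φ ^ i) →
    diag a (suc n) ≋ (λ m → φ ^ suc n * (fromℕ (suc n !) * binomSeq² (suc n) m) + (a (suc n) - φ ^ suc n) * perturbationDiag (suc n) m)
  diag-perturbed {a} {φ} n a0≈1 a≈ m = begin
    P * (a ^ₛ suc m) (suc n)                              ≈⟨ *-congˡ (^ₛ-perturbed n a0≈1 a≈ m) ⟩
    P * (negBinomial m φ (suc n) + fromℕ (suc m) * ε)     ≈⟨ distribˡ _ _ _ ⟩
    P * negBinomial m φ (suc n) + P * (fromℕ (suc m) * ε) ≈⟨ +-cong (fallingRatio*negBinomial φ (suc n) m) (sym (*-assoc _ _ _)) ⟩
    φ ^ suc n * (fromℕ (suc n !) * binomSeq² (suc n) m) + (P * fromℕ (suc m)) * ε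
                                                                    ≈⟨ +-congˡ (trans (*-congʳ (sym (fromℕ-* (fallingRatio (suc n) m) (suc m)))) (*-comm _ _)) ⟩
    φ ^ suc n * (fromℕ (suc n !) * binomSeq² (suc n) m) + ε * perturbationDiag (suc n) m ∎
    where
    P = fromℕ (fallingRatio (suc n) m)
    ε = a (suc n) - φ ^ suc n

  numerator-perturbed : ∀ {a : Series} {φ} n → a 0 ≈ 1# → (∀ i → i ℕ.≤ n → a i ≈ φ ^ i) → ∀ l →
    numerator a (suc n) l ≈ φ ^ suc n * (fromℕ (suc n !) * (binom (suc n) l * binom (suc n) l))
                              + (a (suc n) - φ ^ suc n) * ∇[ 2 ℕ.* suc n ℕ.+ 1 ] (perturbationDiag (suc n)) l
  numerator-perturbed {a} {φ} n a0≈1 a≈ l = begin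
    numerator a (suc n) l                                                           ≈⟨ numerator≈∇[2n+1]diag a (suc n) l ⟩
    ∇[ p ] (diag a (suc n)) l                                                       ≈⟨ ∇[]-cong p (diag-perturbed n a0≈1 a≈) l ⟩
    ∇[ p ] (λ m → x * (y * binomSeq² (suc n) m) + ε * perturbationDiag (suc n) m) l ≈⟨ ∇[]-+ₛ p _ _ l ⟩
    ∇[ p ] (λ m → x * (y * binomSeq² (suc n) m)) l + ∇[ p ] (λ m → ε * perturbationDiag (suc n) m) l
                                                                   ≈⟨ +-cong (trans (∇[]-*ˡ p x _ l) (*-congˡ (∇[]-*ˡ p y _ l))) (∇[]-*ˡ p ε _ l) ⟩
    x * (y * ∇[ p ] (binomSeq² (suc n)) l) + ε * ∇[ p ] (perturbationDiag (suc n)) l        ≈⟨ +-congʳ (*-congˡ (*-congˡ (∇[]-binomSeq² (suc n) l))) ⟩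
    x * (y * (binom (suc n) l * binom (suc n) l)) + ε * ∇[ p ] (perturbationDiag (suc n)) l ∎
    where
    p = 2 ℕ.* suc n ℕ.+ 1
    x = φ ^ suc n
    y = fromℕ (suc n !)
    ε = a (suc n) - φ ^ suc n

  ∇[]-at-0 : ∀ p u → ∇[ p ] u 0 ≈ u 0
  ∇[]-at-0 zero    u = refl
  ∇[]-at-0 (suc p) u = ∇[]-at-0 p u

  ∇[]-perturbationDiag-0 : ∀ p N → ∇[ p ] (perturbationDiag N) 0 ≈ fromℕ (N !)
  ∇[]-perturbationDiag-0 p N = trans (∇[]-at-0 p (perturbationDiag N))
    (fromℕ-cong (≡.trans (ℕ.*-identityʳ _) (≡.trans (≡.cong (_P N) (ℕ.+-identityʳ N)) (nPn≡n! N))))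

  perturbationDiag-decomposition : ∀ N → perturbationDiag N ≋ (λ m → fromℕ (N ! ℕ.* suc N) * binomSeq (suc N) m + (- fromℕ (N ! ℕ.* N)) * binomSeq N m)
  perturbationDiag-decomposition N m = sym (begin
    c₁ * binomSeq (suc N) m + (- c₂) * binomSeq N m  ≈⟨ +-congˡ (sym (-‿distribˡ-* c₂ _)) ⟩
    c₁ * binomSeq (suc N) m - c₂ * binomSeq N m      ≈⟨ x≈y+z⇒x-z≈y (begin
      c₁ * binomSeq (suc N) m                             ≈⟨ fromℕ-* (N ! ℕ.* suc N) ((suc N ℕ.+ m) C suc N) ⟨
      fromℕ ((N ! ℕ.* suc N) ℕ.* ((suc N ℕ.+ m) C suc N)) ≈⟨ fromℕ-cong ([n+m]Pn*[1+m]+n!*n*[n+m]Cn≡n!*[1+n]*[1+n+m]C[1+n] N m) ⟨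
      fromℕ (fallingRatio N m ℕ.* suc m ℕ.+ (N ! ℕ.* N) ℕ.* ((N ℕ.+ m) C N))
                                                             ≈⟨ fromℕ-+ (fallingRatio N m ℕ.* suc m) ((N ! ℕ.* N) ℕ.* ((N ℕ.+ m) C N)) ⟩
      perturbationDiag N m + fromℕ ((N ! ℕ.* N) ℕ.* ((N ℕ.+ m) C N))     ≈⟨ +-congˡ (fromℕ-* (N ! ℕ.* N) ((N ℕ.+ m) C N)) ⟩
      perturbationDiag N m + c₂ * binomSeq N m                           ∎) ⟩
    perturbationDiag N m                                         ∎)
    where
    c₁ = fromℕ (N ! ℕ.* suc N)
    c₂ = fromℕ (N ! ℕ.* N)

  ∇[]-perturbationDiag-top : ∀ n → ∇[ 2 ℕ.* suc n ℕ.+ 1 ] (perturbationDiag (suc n)) (suc n) ≈ - (fromℕ (suc n ! ℕ.* suc n) * sign (suc n))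
  ∇[]-perturbationDiag-top n = begin
    ∇[ p ] (perturbationDiag N) N                                    ≈⟨ ∇[]-cong p (perturbationDiag-decomposition N) N ⟩
    ∇[ p ] (λ m → c₁ * binomSeq (suc N) m + (- c₂) * binomSeq N m) N ≈⟨ ∇[]-+ₛ p _ _ N ⟩
    ∇[ p ] (λ m → c₁ * binomSeq (suc N) m) N + ∇[ p ] (λ m → (- c₂) * binomSeq N m) N
                                                                          ≈⟨ +-cong (∇[]-*ˡ p c₁ _ N) (∇[]-*ˡ p (- c₂) _ N) ⟩
    c₁ * ∇[ p ] (binomSeq (suc N)) N + (- c₂) * ∇[ p ] (binomSeq N) N     ≈⟨ +-cong (*-congˡ ∇[p]-binomSeq[N+1]) (*-congˡ ∇[p]-binomSeq[N]) ⟩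
    c₁ * (sign N * binom n N) + (- c₂) * (sign N * binom N N)              ≈⟨ +-cong (trans (*-congˡ (trans (*-congˡ (binom-zero (ℕ.n<1+n n))) (zeroʳ _))) (zeroʳ _))
                                                                                    (*-congˡ (trans (*-congˡ (binom-diag N)) (*-identityʳ _))) ⟩
    0# + (- c₂) * sign N ≈⟨ trans (+-identityˡ _) (sym (-‿distribˡ-* c₂ _)) ⟩
    - (c₂ * sign N)      ∎
    where
    N = suc n
    p = 2 ℕ.* N ℕ.+ 1
    c₁ = fromℕ (N ! ℕ.* suc N)
    c₂ = fromℕ (N ! ℕ.* N)
    2[1+n]+1≡n+[3+n] : ∀ n → 2 ℕ.* suc n ℕ.+ 1 ≡ n ℕ.+ suc (suc (suc n))
    2[1+n]+1≡n+[3+n] = solve-∀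
    2m+1≡m+[1+m] : ∀ m → 2 ℕ.* m ℕ.+ 1 ≡ m ℕ.+ suc m
    2m+1≡m+[1+m] = solve-∀
    ∇[p]-binomSeq[N+1] : ∇[ p ] (binomSeq (suc N)) N ≈ sign N * binom n N
    ∇[p]-binomSeq[N+1] = ∇[]-binomSeq n (suc N) (2[1+n]+1≡n+[3+n] n) N
    ∇[p]-binomSeq[N] : ∇[ p ] (binomSeq N) N ≈ sign N * binom N N
    ∇[p]-binomSeq[N] = ∇[]-binomSeq N N (2m+1≡m+[1+m] N) N

  1+N*sign[N]≉0 : ∀ n → ¬ (1# + fromℕ (suc (suc n)) * sign (suc (suc n)) ≈ 0#)
  1+N*sign[N]≉0 n z with sign≈±1 (suc (suc n))
  ... | inj₁ s≈1  = char0 (suc (suc n)) (trans (+-congˡ (sym (trans (*-congˡ s≈1) (*-identityʳ _)))) z)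
  ... | inj₂ s≈-1 = char0 n (begin
    fromℕ (suc n)               ≈⟨ trans (+-congʳ (-‿inverseˡ 1#)) (+-identityˡ _) ⟨
    (- 1# + 1#) + fromℕ (suc n) ≈⟨ +-assoc _ _ _ ⟩
    - 1# + fromℕ N              ≈⟨ +-congˡ (⁻¹-involutive _) ⟨
    - 1# + - - fromℕ N          ≈⟨ -‿+-distrib _ _ ⟨
    - (1# + - fromℕ N)          ≈⟨ -‿cong (+-congˡ (trans (-‿cong (sym (*-identityʳ _))) (trans (-‿distribʳ-* _ 1#) (*-congˡ (sym s≈-1))))) ⟩
    - (1# + fromℕ N * sign N)   ≈⟨ -‿cong z ⟩
    - 0#                        ≈⟨ ε⁻¹≈ε ⟩
    0#                                         ∎)
    where N = suc (suc n)

  fromℕ-n!≉0 : ∀ n → ¬ (fromℕ (n !) ≈ 0#)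
  fromℕ-n!≉0 n with n ! | ℕ.1≤n! n
  ... | suc k | _ = char0 k

  x*y≈x*-z⇒x*[y+z]≈0 : ∀ {x y z} → x * y ≈ x * (- z) → x * (y + z) ≈ 0#
  x*y≈x*-z⇒x*[y+z]≈0 {x} {y} {z} xy≈x[-z] = begin
    x * (y + z)       ≈⟨ distribˡ x y z ⟩
    x * y + x * z     ≈⟨ +-congʳ xy≈x[-z] ⟩
    x * (- z) + x * z ≈⟨ distribˡ x (- z) z ⟨
    x * (- z + z)     ≈⟨ *-congˡ (-‿inverseˡ z) ⟩
    x * 0#            ≈⟨ zeroʳ x ⟩
    0#                ∎

  perturbation-vanishes : ∀ {a : Series} {φ} n → a 0 ≈ 1# → (∀ i → i ℕ.≤ suc n → a i ≈ φ ^ i) →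
    SymmetricOfDegree (suc (suc n)) (numerator a (suc (suc n))) → a (suc (suc n)) ≈ φ ^ suc (suc n)
  perturbation-vanishes {a} {φ} n a0≈1 a≈ (palindromic , _) = begin
    a N        ≈⟨ x≈y+[x-y] _ _ ⟩
    φ ^ N + ε  ≈⟨ +-congˡ (x*y≈0⇒x≈0 weight≉0 (x*y≈x*-z⇒x*[y+z]≈0 ε*W[0]≈ε*W[N])) ⟩
    φ ^ N + 0# ≈⟨ +-identityʳ _ ⟩
    φ ^ N      ∎
    where
    N = suc (suc n)
    p = 2 ℕ.* N ℕ.+ 1
    ε = a N - φ ^ N
    c₂ = fromℕ (N ! ℕ.* N)
    G : ℕ → Carrier
    G l = φ ^ N * (fromℕ (N !) * (binom N l * binom N l))
    G[N]≈G[0] : G N ≈ G 0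
    G[N]≈G[0] = *-congˡ (*-congˡ (*-cong binom[N][N]≈binom[N][0] binom[N][N]≈binom[N][0]))
      where binom[N][N]≈binom[N][0] = trans (binom-diag N) (sym (+-identityʳ 1#))
    ε*W[0]≈ε*W[N] : ε * fromℕ (N !) ≈ ε * - (c₂ * sign N)
    ε*W[0]≈ε*W[N] = +-cancelˡ (G 0) _ _ (begin
      G 0 + ε * fromℕ (N !)                   ≈⟨ +-congˡ (*-congˡ (∇[]-perturbationDiag-0 p N)) ⟨
      G 0 + ε * ∇[ p ] (perturbationDiag N) 0 ≈⟨ numerator-perturbed (suc n) a0≈1 a≈ 0 ⟨
      numerator a N 0                         ≈⟨ reflexive (≡.cong (numerator a N) (ℕ.n∸n≡0 N)) ⟨
      numerator a N (N ∸ N)                   ≈⟨ palindromic N ℕ.≤-refl ⟨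
      numerator a N N                         ≈⟨ numerator-perturbed (suc n) a0≈1 a≈ N ⟩
      G N + ε * ∇[ p ] (perturbationDiag N) N ≈⟨ +-cong G[N]≈G[0] (*-congˡ (∇[]-perturbationDiag-top (suc n))) ⟩
      G 0 + ε * - (c₂ * sign N)              ∎)
    weight≉0 : ¬ (fromℕ (N !) + c₂ * sign N ≈ 0#)
    weight≉0 = λ z → x≉0∧y≉0⇒x*y≉0 (fromℕ-n!≉0 N) (1+N*sign[N]≉0 n) (trans (sym factorise) z)
      where
      factorise : fromℕ (N !) + c₂ * sign N ≈ fromℕ (N !) * (1# + fromℕ N * sign N)
      factorise = begin
        fromℕ (N !) + c₂ * sign N                           ≈⟨ +-cong (*-identityʳ _) (*-congʳ (sym (fromℕ-* (N !) N))) ⟨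
        fromℕ (N !) * 1# + (fromℕ (N !) * fromℕ N) * sign N ≈⟨ +-congˡ (*-assoc _ _ _) ⟩
        fromℕ (N !) * 1# + fromℕ (N !) * (fromℕ N * sign N) ≈⟨ distribˡ _ _ _ ⟨
        fromℕ (N !) * (1# + fromℕ N * sign N)               ∎

  forward : ∀ (a : Series) → a 0 ≈ 1# → (∀ n → SymmetricOfDegree n (numerator a n)) → ∃ λ φ → ∀ n → a n ≈ geometric φ n
  forward a a0≈1 symmetric = φ , λ n → agreesBelow (suc n) n ℕ.≤-refl
    where
    φ = a 1
    next : ∀ N → (∀ i → i ℕ.< N → a i ≈ φ ^ i) → a N ≈ φ ^ N
    next zero          _     = a0≈1
    next (suc zero)    _     = sym (*-identityʳ φ)
    next (suc (suc n)) agree = perturbation-vanishes n a0≈1 (λ i i≤1+n → agree i (s≤s i≤1+n)) (symmetric (suc (suc n)))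
    agreesBelow : ∀ N i → i ℕ.< N → a i ≈ φ ^ i
    agreesBelow (suc N) i (s≤s i≤N) with ℕ.m≤n⇒m<n∨m≡n i≤N
    ... | inj₁ i<N    = agreesBelow N i i<N
    ... | inj₂ ≡.refl = next N (agreesBelow N)

theorem4p4 : ∀ {c ℓ} (K : Char0Field c ℓ) → let open Char0Field K in let open FPS K in
    (a : Series) → a 0 ≈ 1# →
    ((∀ n → SymmetricOfDegree n (numerator a n))
      ⇔ (∃ λ φ → ∀ n → a n ≈ geometric φ n))
theorem4p4 K a a0≈1 = mk⇔ (forward a a0≈1) (backward a)
  where open Development K
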